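{- For any $k\geq 0$ and $n\geq 1$, $$op_{n+1,k+1}^{k+2}=op_{n,k}^{k+1}+op_{n,k+1}^{k+1}+op_{n,k+1}^{k+2},$$ where $op_{n,k}^m$ denotes the number of ordered preference sets of length $n$ with exactly $k$ flaws and leading term $m$.
   Context: Parking model: $n$ parking spaces numbered $1,\dots,n$ from left to right; a preference set of length $n$ is a sequence $(a_1,\dots,a_n)$ with $a_i\in[n]$. Cars arrive in order; car $i$ goes to space $a_i$, and if it is occupied, moves to the first unoccupied space to the right; if there is none, the car cannot park. The number of flaws is the number of cars that cannot park. A preference set is ordered if $a_1\leq\cdots\leq a_n$; its leading term is $a_1$. A count over an empty set is $0$. -}

module Defs where

open import Data.Nat using (ℕ; zero; suc; _+_; _≤ᵇ_; _≡ᵇ_)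
open import Data.Bool using (Bool; true; false; if_then_else_; _∧_; T)
open import Data.Bool.Properties using (T?)
open import Data.Bool.ListAction using (any)
open import Data.List using (List; []; _∷_; map; concatMap; filter; length; upTo)
open import Data.Nat.Properties using (_≟_)
open import Relation.Nullary.Decidable using (⌊_⌋)

range1 : ℕ → List ℕ
range1 n = map suc (upTo n)

allSeqs : ℕ → ℕ → List (List ℕ)
allSeqs n zero = [] ∷ []
allSeqs n (suc len) = concatMap (λ a → map (a ∷_) (allSeqs n len)) (range1 n)

prefSets : ℕ → List (List ℕ)
prefSets n = allSeqs n n

memb : ℕ → List ℕ → Bool
memb x xs = any (λ y → ⌊ x ≟ y ⌋) xs

-- try spaces s, s+1, ..., using `fuel` steps; returns the first unoccupied space
-- among s .. n (fuel = n + 1 - s suffices), or nothing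
data Maybeℕ : Set where
  none : Maybeℕ
  some : ℕ → Maybeℕ

findSpot : (n : ℕ) → (occ : List ℕ) → (s : ℕ) → (fuel : ℕ) → Maybeℕ
findSpot n occ s zero = none
findSpot n occ s (suc fuel) =
  if s ≤ᵇ n
  then (if memb s occ then findSpot n occ (suc s) fuel else some s)
  else none

-- run the parking process on n spaces with occupied list occ;
-- returns the number of cars that cannot park (flaws)
flawsFrom : ℕ → List ℕ → List ℕ → ℕ
flawsFrom n occ [] = 0
flawsFrom n occ (a ∷ as) with findSpot n occ a (suc n)
... | none = suc (flawsFrom n occ as)
... | some s = flawsFrom n (s ∷ occ) as

flaws : ℕ → List ℕ → ℕ
flaws n prefs = flawsFrom n [] prefs

isOrdered : List ℕ → Bool
isOrdered [] = true
isOrdered (a ∷ []) = true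
isOrdered (a ∷ b ∷ as) = (a ≤ᵇ b) ∧ isOrdered (b ∷ as)

leadingIs : ℕ → List ℕ → Bool
leadingIs m [] = false
leadingIs m (a ∷ _) = m ≡ᵇ a

op : ℕ → ℕ → ℕ → ℕ
op n k m = length (filter (λ p → T? (isOrdered p ∧ ((flaws n p ≡ᵇ k) ∧ leadingIs m p))) (prefSets n))

module Submission where

-- Lowering every entry by one, a preference set counted on the left becomes
-- (k + 1, r) with r an ordered preference set of length n whose entries are
-- at least k + 1.  The first car takes space k + 2, so the others park as r
-- does on n spaces with the first k + 1 spaces taken.  For an ordered set of
-- length n, taking the first t spaces just raises its number f of flaws to
-- max(f, t), so the count is max(f, k + 1).  As an ordered r with
-- leading term b has at least b − 1 flaws, max(f, k + 1) = k + 1 holds exactly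
-- when b = k + 1 and f ∈ {k, k + 1}, or b = k + 2 and f = k + 1.

open import Defs
open import Data.Nat using (ℕ; zero; suc; pred; _+_; _∸_; _⊔_; _≤_; _<_; _≥_; z≤n; s≤s; _≤ᵇ_; _≡ᵇ_)
open import Data.Nat.Properties
open import Data.Nat.ListAction using (sum)
open import Data.Nat.Tactic.RingSolver using (solve-∀)
open import Data.Bool using (Bool; true; false; T; _∧_; _∨_)
open import Data.Bool.Properties using (T?; ∧-zeroʳ; ∧-identityʳ; ∨-zeroʳ; ∧-conicalˡ; ∧-conicalʳ)
open import Data.List using (List; []; _∷_; map; concatMap; filter; length; _++_)
open import Data.List.Properties using (map-upTo; map-∘; map-cong)
open import Data.List.Membership.Propositional using (_∈_)
open import Data.List.Relation.Unary.Any using (here; there)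
open import Data.List.Relation.Unary.All as All using (All; []; _∷_)
open import Data.List.Relation.Unary.All.Properties using (map⁺; concat⁺)
open import Data.List.Relation.Unary.Linked as Linked using (Linked; []; [-]; _∷_)
open import Data.List.Relation.Unary.Linked.Properties as Linkedₚ using (Linked⇒All)
open import Data.Product using (_×_; _,_; proj₁; proj₂)
open import Function using (_∘_)
open import Relation.Nullary using (yes; no; contradiction)
open import Relation.Nullary.Decidable using (dec-true; dec-false; ⌊_⌋)
open import Relation.Binary.PropositionalEquality

≤ᵇ-true : ∀ {m n} → m ≤ n → (m ≤ᵇ n) ≡ true
≤ᵇ-true {m} {n} = dec-true (m ≤? n)

≤ᵇ-false : ∀ {m n} → n < m → (m ≤ᵇ n) ≡ false
≤ᵇ-false {m} {n} n<m = dec-false (m ≤? n) (<⇒≱ n<m)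

≡ᵇ-refl : ∀ m → (m ≡ᵇ m) ≡ true
≡ᵇ-refl m = dec-true (m ≟ m) refl

≡ᵇ-false : ∀ {m n} → m ≢ n → (m ≡ᵇ n) ≡ false
≡ᵇ-false {m} {n} = dec-false (m ≟ n)

∧-cong-if : ∀ {x x′ y y′} → x ≡ x′ → (x′ ≡ true → y ≡ y′) → x ∧ y ≡ x′ ∧ y′
∧-cong-if {x′ = true}  refl y≡y′ = y≡y′ refl
∧-cong-if {x′ = false} refl _    = refl

ind : Bool → ℕ
ind true  = 1
ind false = 0

private
  variable
    A B : Set

count : (A → Bool) → List A → ℕ
count p xs = length (filter (λ x → T? (p x)) xs)

count-∷ : ∀ (p : A → Bool) x xs → count p (x ∷ xs) ≡ ind (p x) + count p xs
count-∷ p x xs with p x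
... | true  = refl
... | false = refl

count-++ : ∀ (p : A → Bool) xs ys → count p (xs ++ ys) ≡ count p xs + count p ys
count-++ p []       ys = refl
count-++ p (x ∷ xs) ys = begin
  count p (x ∷ xs ++ ys)                 ≡⟨ count-∷ p x (xs ++ ys) ⟩
  ind (p x) + count p (xs ++ ys)         ≡⟨ cong (ind (p x) +_) (count-++ p xs ys) ⟩
  ind (p x) + (count p xs + count p ys)  ≡⟨ sym (+-assoc (ind (p x)) _ _) ⟩
  ind (p x) + count p xs + count p ys    ≡⟨ cong (_+ count p ys) (sym (count-∷ p x xs)) ⟩
  count p (x ∷ xs) + count p ys          ∎
  where open ≡-Reasoning

count-map : ∀ (p : B → Bool) (f : A → B) xs → count p (map f xs) ≡ count (p ∘ f) xs
count-map p f []       = refl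
count-map p f (x ∷ xs) =
  trans (count-∷ p (f x) (map f xs))
        (trans (cong (ind (p (f x)) +_) (count-map p f xs)) (sym (count-∷ (p ∘ f) x xs)))

count-concatMap : ∀ (p : B → Bool) (g : A → List B) xs →
                  count p (concatMap g xs) ≡ sum (map (count p ∘ g) xs)
count-concatMap p g []       = refl
count-concatMap p g (x ∷ xs) =
  trans (count-++ p (g x) (concatMap g xs)) (cong (count p (g x) +_) (count-concatMap p g xs))

count-none : ∀ (p : A → Bool) xs → (∀ x → p x ≡ false) → count p xs ≡ 0
count-none p []       _     = refl
count-none p (x ∷ xs) never = trans (count-∷ p x xs) (cong₂ _+_ (cong ind (never x)) (count-none p xs never))

count-split₃ : ∀ (p q r s : A → Bool) xs →
               All (λ x → ind (p x) ≡ ind (q x) + ind (r x) + ind (s x)) xs →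
               count p xs ≡ count q xs + count r xs + count s xs
count-split₃ p q r s []       []         = refl
count-split₃ p q r s (x ∷ xs) (px ∷ pxs) = begin
  count p (x ∷ xs)
    ≡⟨ count-∷ p x xs ⟩
  ind (p x) + count p xs
    ≡⟨ cong₂ _+_ px (count-split₃ p q r s xs pxs) ⟩
  (ind (q x) + ind (r x) + ind (s x)) + (count q xs + count r xs + count s xs)
    ≡⟨ interchange (ind (q x)) (ind (r x)) (ind (s x)) (count q xs) (count r xs) (count s xs) ⟩
  (ind (q x) + count q xs) + (ind (r x) + count r xs) + (ind (s x) + count s xs)
    ≡⟨ sym (cong₂ _+_ (cong₂ _+_ (count-∷ q x xs) (count-∷ r x xs)) (count-∷ s x xs)) ⟩
  count q (x ∷ xs) + count r (x ∷ xs) + count s (x ∷ xs)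
    ∎
  where
  open ≡-Reasoning
  interchange : ∀ a b c d e f → a + b + c + (d + e + f) ≡ a + d + (b + e) + (c + f)
  interchange = solve-∀

range1-suc : ∀ N → range1 (suc N) ≡ 1 ∷ map suc (range1 N)
range1-suc N = cong (λ l → 1 ∷ map suc l) (sym (map-upTo suc N))

range1-≤ : ∀ N → All (_≤ N) (range1 N)
range1-≤ zero    = []
range1-≤ (suc N) rewrite range1-suc N = s≤s z≤n ∷ map⁺ (All.map s≤s (range1-≤ N))

sum-range1-suc : ∀ N (f : ℕ → ℕ) → sum (map f (range1 (suc N))) ≡ f 1 + sum (map (f ∘ suc) (range1 N))
sum-range1-suc N f =
  trans (cong (sum ∘ map f) (range1-suc N)) (cong (λ l → f 1 + sum l) (sym (map-∘ (range1 N))))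

sum-range1-zero : ∀ N (f : ℕ → ℕ) → (∀ {a} → a < N → f (suc a) ≡ 0) → sum (map f (range1 N)) ≡ 0
sum-range1-zero zero    f _    = refl
sum-range1-zero (suc N) f vanish =
  trans (sum-range1-suc N f) (cong₂ _+_ (vanish (s≤s z≤n)) (sum-range1-zero N (f ∘ suc) (vanish ∘ s≤s)))

sum-range1-single : ∀ N (f : ℕ → ℕ) {m} → (∀ {a} → a ≢ m → f a ≡ 0) → 1 ≤ m → m ≤ N →
                    sum (map f (range1 N)) ≡ f m
sum-range1-single (suc N) f {suc zero} vanish _ _ =
  trans (sum-range1-suc N f)
        (trans (cong (f 1 +_) (sum-range1-zero N (f ∘ suc) (λ _ → vanish (λ ())))) (+-identityʳ (f 1)))
sum-range1-single (suc N) f {suc (suc m)} vanish _ (s≤s m<N) =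
  trans (sum-range1-suc N f)
        (cong₂ _+_ (vanish (λ ()))
                   (sum-range1-single N (f ∘ suc) (λ a≢m → vanish (a≢m ∘ suc-injective)) (s≤s z≤n) m<N))

allSeqs-shape : ∀ N L → All (λ r → length r ≡ L × All (_≤ N) r) (allSeqs N L)
allSeqs-shape N zero    = (refl , []) ∷ []
allSeqs-shape N (suc L) =
  concat⁺ (map⁺ (All.map (λ a≤N → map⁺ (All.map (λ (len , r≤N) → cong suc len , a≤N ∷ r≤N)
                                                  (allSeqs-shape N L)))
                         (range1-≤ N)))

count-allSeqs-suc : ∀ N L (P : List ℕ → Bool) →
                    count P (allSeqs N (suc L)) ≡ sum (map (λ a → count (P ∘ (a ∷_)) (allSeqs N L)) (range1 N))
count-allSeqs-suc N L P =
  trans (count-concatMap P (λ a → map (a ∷_) (allSeqs N L)) (range1 N))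
        (cong sum (map-cong (λ a → count-map P (a ∷_) (allSeqs N L)) (range1 N)))

ForcesLead : ℕ → (List ℕ → Bool) → Set
ForcesLead m P = ∀ a s → a ≢ m → P (a ∷ s) ≡ false

count-allSeqs-lead : ∀ {N L m} (P : List ℕ → Bool) → ForcesLead m P → 1 ≤ m → m ≤ N →
                     count P (allSeqs N (suc L)) ≡ count (P ∘ (m ∷_)) (allSeqs N L)
count-allSeqs-lead {N} {L} P lead 1≤m m≤N =
  trans (count-allSeqs-suc N L P)
        (sum-range1-single N _ (λ {a} a≢m → count-none _ (allSeqs N L) (λ s → lead a s a≢m)) 1≤m m≤N)

count-allSeqs-lead-absent : ∀ {N L m} (P : List ℕ → Bool) → ForcesLead m P → N < m →
                            count P (allSeqs N (suc L)) ≡ 0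
count-allSeqs-lead-absent {N} {L} {m} P lead N<m =
  trans (count-allSeqs-suc N L P)
        (sum-range1-zero N _ (λ {a} a<N → count-none _ (allSeqs N L) (λ s → lead (suc a) s (a+1≢m a<N))))
  where
  a+1≢m : ∀ {a} → a < N → suc a ≢ m
  a+1≢m a<N refl = <⇒≱ a<N (≤-pred N<m)

count-allSeqs-shift : ∀ N L (P : List ℕ → Bool) → (∀ {s} → P s ≡ true → All (2 ≤_) s) →
                      count P (allSeqs (suc N) L) ≡ count (P ∘ map suc) (allSeqs N L)
count-allSeqs-shift N zero    P _      = trans (count-∷ P [] []) (sym (count-∷ (P ∘ map suc) [] []))
count-allSeqs-shift N (suc L) P above1 = begin
  count P (allSeqs (suc N) (suc L))
    ≡⟨ count-allSeqs-suc (suc N) L P ⟩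
  sum (map (λ a → count (P ∘ (a ∷_)) (allSeqs (suc N) L)) (range1 (suc N)))
    ≡⟨ sum-range1-suc N _ ⟩
  count (P ∘ (1 ∷_)) (allSeqs (suc N) L)
    + sum (map (λ a → count (P ∘ (suc a ∷_)) (allSeqs (suc N) L)) (range1 N))
    ≡⟨ cong₂ _+_ (count-none _ (allSeqs (suc N) L) (λ _ → no-lead-1))
                 (cong sum (map-cong (λ a → count-allSeqs-shift N L (P ∘ (suc a ∷_)) (All.tail ∘ above1))
                                     (range1 N))) ⟩
  sum (map (λ a → count (P ∘ map suc ∘ (a ∷_)) (allSeqs N L)) (range1 N))
    ≡⟨ sym (count-allSeqs-suc N L (P ∘ map suc)) ⟩
  count (P ∘ map suc) (allSeqs N (suc L))
    ∎
  where
  open ≡-Reasoning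
  no-lead-1 : ∀ {s} → P (1 ∷ s) ≡ false
  no-lead-1 {s} with P (1 ∷ s) in eq
  ... | false = refl
  ... | true  with above1 eq
  ...   | s≤s () ∷ _

-- Flaws of an ordered preference set when every space below t is taken and
-- every space from t on is free: a car preferring b heads for b ⊔ t.
flawsAbove : ℕ → ℕ → List ℕ → ℕ
flawsAbove n t []       = 0
flawsAbove n t (b ∷ bs) with b ⊔ t ≤? n
... | yes _ = flawsAbove n (suc (b ⊔ t)) bs
... | no  _ = suc (flawsAbove n t bs)

module _ {n : ℕ} (t b : ℕ) (bs : List ℕ) where

  flawsAbove-park : ∀ {c} → b ⊔ t ≡ c → c ≤ n → flawsAbove n t (b ∷ bs) ≡ flawsAbove n (suc c) bs
  flawsAbove-park refl c≤n with b ⊔ t ≤? n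
  ... | yes _   = refl
  ... | no  c≰n = contradiction c≤n c≰n

  flawsAbove-fail : n < b ⊔ t → flawsAbove n t (b ∷ bs) ≡ suc (flawsAbove n t bs)
  flawsAbove-fail n<c with b ⊔ t ≤? n
  ... | yes c≤n = contradiction c≤n (<⇒≱ n<c)
  ... | no  _   = refl

flawsAbove-≤-length : ∀ n t xs → flawsAbove n t xs ≤ length xs
flawsAbove-≤-length n t []       = z≤n
flawsAbove-≤-length n t (b ∷ bs) with b ⊔ t ≤? n
... | yes _ = m≤n⇒m≤1+n (flawsAbove-≤-length n (suc (b ⊔ t)) bs)
... | no  _ = s≤s (flawsAbove-≤-length n t bs)

flawsAbove-all-fail : ∀ {n t xs} → All (λ b → n < b ⊔ t) xs → flawsAbove n t xs ≡ length xs
flawsAbove-all-fail []           = refl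
flawsAbove-all-fail {xs = b ∷ bs} (n<c ∷ fail) =
  trans (flawsAbove-fail _ b bs n<c) (cong suc (flawsAbove-all-fail fail))

length-≤-flawsAbove : ∀ n t xs → length xs ≤ flawsAbove n t xs + (suc n ∸ t)
length-≤-flawsAbove n t []       = z≤n
length-≤-flawsAbove n t (b ∷ bs) with b ⊔ t ≤? n
... | no  _   = s≤s (length-≤-flawsAbove n t bs)
... | yes c≤n = begin
  suc (length bs)        ≤⟨ s≤s (length-≤-flawsAbove n (suc c) bs) ⟩
  suc (F + (n ∸ c))      ≡⟨ sym (+-suc F (n ∸ c)) ⟩
  F + suc (n ∸ c)        ≡⟨ cong (F +_) (sym (+-∸-assoc 1 c≤n)) ⟩
  F + (suc n ∸ c)        ≤⟨ +-monoʳ-≤ F (∸-monoʳ-≤ (suc n) (m≤n⊔m b t)) ⟩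
  F + (suc n ∸ t)        ∎
  where
  open ≤-Reasoning
  c = b ⊔ t
  F = flawsAbove n (suc c) bs

length-∸-≤-flawsAbove : ∀ {n t b} bs → t < b → b ≤ n →
                        suc (length bs) ∸ (n ∸ t) ≤ flawsAbove n (suc b) bs
length-∸-≤-flawsAbove {n} {t} {b} bs t<b b≤n = m≤n+o⇒m∸n≤o (suc (length bs)) (n ∸ t) (begin
  suc (length bs)      ≤⟨ s≤s (length-≤-flawsAbove n (suc b) bs) ⟩
  suc (F + (n ∸ b))    ≡⟨ cong suc (+-comm F (n ∸ b)) ⟩
  suc (n ∸ b) + F      ≤⟨ +-monoˡ-≤ F (s≤s (∸-monoʳ-≤ n t<b)) ⟩
  suc (n ∸ suc t) + F  ≡⟨ cong (_+ F) (sym (+-∸-assoc 1 (<-≤-trans t<b b≤n))) ⟩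
  (n ∸ t) + F          ∎)
  where
  open ≤-Reasoning
  F = flawsAbove n (suc b) bs

flawsAbove-suc-full : ∀ {n t} xs → n ≤ t →
                      flawsAbove n (suc t) xs ≡ flawsAbove n t xs ⊔ (length xs ∸ (n ∸ t))
flawsAbove-suc-full {n} {t} xs n≤t = begin
  flawsAbove n (suc t) xs
    ≡⟨ flawsAbove-all-fail (All.universal (λ b → <-≤-trans (s≤s n≤t) (m≤n⊔m b (suc t))) xs) ⟩
  length xs
    ≡⟨ sym (m≤n⇒m⊔n≡n (flawsAbove-≤-length n t xs)) ⟩
  flawsAbove n t xs ⊔ length xs
    ≡⟨ cong (λ d → flawsAbove n t xs ⊔ (length xs ∸ d)) (sym (m≤n⇒m∸n≡0 n≤t)) ⟩
  flawsAbove n t xs ⊔ (length xs ∸ (n ∸ t))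
    ∎
  where open ≡-Reasoning

flawsAbove-suc : ∀ n t {xs} → Linked _≤_ xs →
                 flawsAbove n (suc t) xs ≡ flawsAbove n t xs ⊔ (length xs ∸ (n ∸ t))
flawsAbove-suc n t {xs} sorted with t <? n
flawsAbove-suc n t {xs}     sorted | no t≮n = flawsAbove-suc-full xs (≮⇒≥ t≮n)
flawsAbove-suc n t {[]}     []     | yes t<n = sym (0∸n≡0 (n ∸ t))
flawsAbove-suc n t {b ∷ bs} sorted | yes t<n with b ≤? t | b ≤? n
... | yes b≤t | _ = begin
  flawsAbove n (suc t) (b ∷ bs)
    ≡⟨ flawsAbove-park (suc t) b bs (m≤n⇒m⊔n≡n (m≤n⇒m≤1+n b≤t)) t<n ⟩
  flawsAbove n (suc (suc t)) bs
    ≡⟨ flawsAbove-suc n (suc t) (Linked.tail sorted) ⟩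
  flawsAbove n (suc t) bs ⊔ (length bs ∸ (n ∸ suc t))
    ≡⟨ cong₂ _⊔_ (sym (flawsAbove-park t b bs (m≤n⇒m⊔n≡n b≤t) (<⇒≤ t<n)))
                 (cong (suc (length bs) ∸_) (sym (+-∸-assoc 1 t<n))) ⟩
  flawsAbove n t (b ∷ bs) ⊔ (suc (length bs) ∸ (n ∸ t))
    ∎
  where open ≡-Reasoning
... | no b≰t | yes b≤n = begin
  flawsAbove n (suc t) (b ∷ bs)
    ≡⟨ flawsAbove-park (suc t) b bs (m≥n⇒m⊔n≡m t<b) b≤n ⟩
  F
    ≡⟨ sym (m≥n⇒m⊔n≡m excess≤F) ⟩
  F ⊔ (suc (length bs) ∸ (n ∸ t))
    ≡⟨ cong (_⊔ _) (sym (flawsAbove-park t b bs (m≥n⇒m⊔n≡m (<⇒≤ t<b)) b≤n)) ⟩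
  flawsAbove n t (b ∷ bs) ⊔ (suc (length bs) ∸ (n ∸ t))
    ∎
  where
  open ≡-Reasoning
  t<b = ≰⇒> b≰t
  F = flawsAbove n (suc b) bs
  excess≤F = length-∸-≤-flawsAbove bs t<b b≤n
... | no b≰t | no b≰n = begin
  flawsAbove n (suc t) (b ∷ bs)
    ≡⟨ flawsAbove-all-fail (All.map (λ n<x → <-≤-trans n<x (m≤m⊔n _ (suc t))) beyond) ⟩
  suc (length bs)
    ≡⟨ sym (m≥n⇒m⊔n≡m (m∸n≤m (suc (length bs)) (n ∸ t))) ⟩
  suc (length bs) ⊔ (suc (length bs) ∸ (n ∸ t))
    ≡⟨ cong (_⊔ _) (sym (flawsAbove-all-fail (All.map (λ n<x → <-≤-trans n<x (m≤m⊔n _ t)) beyond))) ⟩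
  flawsAbove n t (b ∷ bs) ⊔ (suc (length bs) ∸ (n ∸ t))
    ∎
  where
  open ≡-Reasoning
  beyond : All (n <_) (b ∷ bs)
  beyond = Linked⇒All ≤-trans (≰⇒> b≰n) sorted

flawsAbove-blocked : ∀ n t {xs} → Linked _≤_ xs →
                     flawsAbove n (suc t) xs ≡ flawsAbove n 0 xs ⊔ (length xs ∸ (n ∸ t))
flawsAbove-blocked n zero    sorted = flawsAbove-suc n 0 sorted
flawsAbove-blocked n (suc t) {xs} sorted = begin
  flawsAbove n (suc (suc t)) xs             ≡⟨ flawsAbove-suc n (suc t) sorted ⟩
  flawsAbove n (suc t) xs ⊔ room (suc t)    ≡⟨ cong (_⊔ room (suc t)) (flawsAbove-blocked n t sorted) ⟩
  (F₀ ⊔ room t) ⊔ room (suc t)              ≡⟨ ⊔-assoc F₀ (room t) (room (suc t)) ⟩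
  F₀ ⊔ (room t ⊔ room (suc t))              ≡⟨ cong (F₀ ⊔_) (m≤n⇒m⊔n≡n room-mono) ⟩
  F₀ ⊔ room (suc t)                         ∎
  where
  open ≡-Reasoning
  F₀ = flawsAbove n 0 xs
  room : ℕ → ℕ
  room s = length xs ∸ (n ∸ s)
  room-mono : room t ≤ room (suc t)
  room-mono = ∸-monoʳ-≤ (length xs) (∸-monoʳ-≤ n (n≤1+n t))

flawsAbove-shift : ∀ n t xs → flawsAbove (suc n) (suc t) (map suc xs) ≡ flawsAbove n t xs
flawsAbove-shift n t []       = refl
flawsAbove-shift n t (b ∷ bs) with b ⊔ t ≤? n
... | yes c≤n = trans (flawsAbove-park (suc t) (suc b) (map suc bs) refl (s≤s c≤n))
                      (flawsAbove-shift n (suc (b ⊔ t)) bs)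
... | no  c≰n = trans (flawsAbove-fail (suc t) (suc b) (map suc bs) (s≤s (≰⇒> c≰n)))
                      (cong suc (flawsAbove-shift n t bs))

flawsAbove-lead : ∀ {n b} bs → b ≤ n → length (b ∷ bs) ≡ n → pred b ≤ flawsAbove n 0 (b ∷ bs)
flawsAbove-lead {b = zero} _ _ _ = z≤n
flawsAbove-lead {zero}  {suc b} _ () _
flawsAbove-lead {suc n} {suc b} bs (s≤s b≤n) len = begin
  b                                    ≡⟨ sym (m∸[m∸n]≡n b≤n) ⟩
  n ∸ (n ∸ b)                          ≤⟨ m≤n+o⇒m∸n≤o n (n ∸ b) n≤room+F ⟩
  F                                    ≡⟨ sym (flawsAbove-park 0 (suc b) bs refl (s≤s b≤n)) ⟩
  flawsAbove (suc n) 0 (suc b ∷ bs)    ∎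
  where
  open ≤-Reasoning
  F = flawsAbove (suc n) (suc (suc b)) bs
  n≤room+F : n ≤ (n ∸ b) + F
  n≤room+F = ≤-trans (≤-reflexive (sym (suc-injective len)))
                     (≤-trans (length-≤-flawsAbove (suc n) (suc (suc b)) bs) (≤-reflexive (+-comm F (n ∸ b))))

memb-∈ : ∀ {j occ} → j ∈ occ → memb j occ ≡ true
memb-∈ {j} (here refl) with j ≟ j
... | yes _   = refl
... | no j≢j = contradiction refl j≢j
memb-∈ {j} {y ∷ _} (there j∈occ) = trans (cong (⌊ j ≟ y ⌋ ∨_) (memb-∈ j∈occ)) (∨-zeroʳ ⌊ j ≟ y ⌋)

memb-∉ : ∀ {j t occ} → All (_< t) occ → t ≤ j → memb j occ ≡ false
memb-∉ []           _   = refl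
memb-∉ {j} {occ = y ∷ _} (y<t ∷ below) t≤j with j ≟ y
... | yes refl = contradiction t≤j (<⇒≱ y<t)
... | no  _    = memb-∉ below t≤j

-- occ lists the taken spaces: all of them lie below t, and [lo, t) is full.
Packed : List ℕ → ℕ → ℕ → Set
Packed occ lo t = All (_< t) occ × (∀ {j} → lo ≤ j → j < t → j ∈ occ)

Packed-park : ∀ {occ lo t b} → lo ≤ b → Packed occ lo t → Packed ((b ⊔ t) ∷ occ) b (suc (b ⊔ t))
Packed-park {occ} {lo} {t} {b} lo≤b (below , full) =
  ≤-refl ∷ All.map (λ y<t → m<n⇒m<1+n (<-≤-trans y<t (m≤n⊔m b t))) below , full′
  where
  full′ : ∀ {j} → b ≤ j → j < suc (b ⊔ t) → j ∈ (b ⊔ t) ∷ occ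
  full′ {j} b≤j j≤c with t ≤? j
  ... | yes t≤j = here (≤-antisym (≤-pred j≤c) (⊔-lub b≤j t≤j))
  ... | no  t≰j = there (full (≤-trans lo≤b b≤j) (≰⇒> t≰j))

Packed-raise : ∀ {occ lo lo′ t} → lo ≤ lo′ → Packed occ lo t → Packed occ lo′ t
Packed-raise lo≤lo′ (below , full) = below , λ lo′≤j → full (≤-trans lo≤lo′ lo′≤j)

suc-⊔-below : ∀ {s t} → s < t → suc s ⊔ t ≡ s ⊔ t
suc-⊔-below s<t = trans (m≤n⇒m⊔n≡n s<t) (sym (m≤n⇒m⊔n≡n (<⇒≤ s<t)))

findSpot-park : ∀ {n occ lo t s} f → Packed occ lo t → lo ≤ s → n < f + s → s ⊔ t ≤ n →
                findSpot n occ s f ≡ some (s ⊔ t)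
findSpot-park {t = t} {s} zero _ _ n<s c≤n = contradiction (≤-trans (m≤m⊔n s t) c≤n) (<⇒≱ n<s)
findSpot-park {n} {t = t} {s} (suc f) packed lo≤s n<f+s c≤n
  rewrite ≤ᵇ-true (≤-trans (m≤m⊔n s t) c≤n) with t ≤? s
... | yes t≤s rewrite memb-∉ (proj₁ packed) t≤s = cong some (sym (m≥n⇒m⊔n≡m t≤s))
... | no  t≰s rewrite memb-∈ (proj₂ packed lo≤s (≰⇒> t≰s)) =
  trans (findSpot-park f packed (m≤n⇒m≤1+n lo≤s) (subst (n <_) (sym (+-suc f s)) n<f+s)
                       (subst (_≤ n) (sym next) c≤n))
        (cong some next)
  where
  next = suc-⊔-below (≰⇒> t≰s)

findSpot-fail : ∀ {n occ lo t s} f → Packed occ lo t → lo ≤ s → n < s ⊔ t → findSpot n occ s f ≡ none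
findSpot-fail zero _ _ _ = refl
findSpot-fail {n} {t = t} {s} (suc f) packed lo≤s n<c with s ≤? n
... | no  s≰n rewrite ≤ᵇ-false (≰⇒> s≰n) = refl
... | yes s≤n rewrite ≤ᵇ-true s≤n with t ≤? s
...   | yes t≤s = contradiction (subst (n <_) (m≥n⇒m⊔n≡m t≤s) n<c) (≤⇒≯ s≤n)
...   | no  t≰s rewrite memb-∈ (proj₂ packed lo≤s (≰⇒> t≰s)) =
  findSpot-fail f packed (m≤n⇒m≤1+n lo≤s) (subst (n <_) (sym (suc-⊔-below (≰⇒> t≰s))) n<c)

flawsFrom-flawsAbove : ∀ {n occ lo t xs} → Packed occ lo t → Linked _≤_ (lo ∷ xs) →
                       flawsFrom n occ xs ≡ flawsAbove n t xs
flawsFrom-flawsAbove {xs = []} _ _ = refl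
flawsFrom-flawsAbove {n} {t = t} {b ∷ bs} packed (lo≤b ∷ sorted) with b ⊔ t ≤? n
... | yes c≤n rewrite findSpot-park (suc n) packed lo≤b (s≤s (m≤m+n n b)) c≤n =
  flawsFrom-flawsAbove (Packed-park lo≤b packed) sorted
... | no  c≰n rewrite findSpot-fail (suc n) packed lo≤b (≰⇒> c≰n) =
  cong suc (flawsFrom-flawsAbove (Packed-raise lo≤b packed) sorted)

flaws-ordered : ∀ n {xs} → Linked _≤_ xs → flaws n xs ≡ flawsAbove n 0 xs
flaws-ordered n {[]}    _      = refl
flaws-ordered n {_ ∷ _} sorted = flawsFrom-flawsAbove ([] , λ _ ()) (z≤n ∷ sorted)

isOrdered⇒Linked : ∀ {xs} → isOrdered xs ≡ true → Linked _≤_ xs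
isOrdered⇒Linked {[]}         _   = []
isOrdered⇒Linked {a ∷ []}     _   = [-]
isOrdered⇒Linked {a ∷ b ∷ xs} ord =
  ≤ᵇ⇒≤ a b (subst T (sym (∧-conicalˡ _ _ ord)) _) ∷ isOrdered⇒Linked (∧-conicalʳ _ _ ord)

isOrdered-map-suc : ∀ xs → isOrdered (map suc xs) ≡ isOrdered xs
isOrdered-map-suc []           = refl
isOrdered-map-suc (a ∷ [])     = refl
isOrdered-map-suc (a ∷ b ∷ xs) = cong₂ _∧_ (suc-≤ᵇ-suc a) (isOrdered-map-suc (b ∷ xs))
  where
  suc-≤ᵇ-suc : ∀ a → (suc a ≤ᵇ suc b) ≡ (a ≤ᵇ b)
  suc-≤ᵇ-suc zero    = refl
  suc-≤ᵇ-suc (suc a) = refl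

opTest : ℕ → ℕ → ℕ → List ℕ → Bool
opTest n k m p = isOrdered p ∧ ((flaws n p ≡ᵇ k) ∧ leadingIs m p)

opTest-lead : ∀ {n k m} → ForcesLead m (opTest n k m)
opTest-lead {n} {k} {m} a s a≢m =
  trans (cong (λ e → isOrdered (a ∷ s) ∧ ((flaws n (a ∷ s) ≡ᵇ k) ∧ e)) (≡ᵇ-false (a≢m ∘ sym)))
        (trans (cong (isOrdered (a ∷ s) ∧_) (∧-zeroʳ _)) (∧-zeroʳ _))

op-absent : ∀ {n k m} → suc n < m → op (suc n) k m ≡ 0
op-absent {n} {k} {m} = count-allSeqs-lead-absent {L = n} (opTest (suc n) k m) (opTest-lead {suc n} {k})

flaws-shift-lead : ∀ {n k r} → suc k ≤ n → length r ≡ n → Linked _≤_ (suc k ∷ r) →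
                   flaws (suc n) (suc (suc k) ∷ map suc r) ≡ flaws n r ⊔ suc k
flaws-shift-lead {n} {k} {r} k<n len sorted = begin
  flaws (suc n) (suc (suc k) ∷ map suc r)
    ≡⟨ flaws-ordered (suc n) (Linkedₚ.map⁺ (Linked.map s≤s sorted)) ⟩
  flawsAbove (suc n) 0 (suc (suc k) ∷ map suc r)
    ≡⟨ flawsAbove-park 0 (suc (suc k)) (map suc r) refl (s≤s k<n) ⟩
  flawsAbove (suc n) (suc (suc (suc k))) (map suc r)
    ≡⟨ flawsAbove-shift n (suc (suc k)) r ⟩
  flawsAbove n (suc (suc k)) r
    ≡⟨ flawsAbove-blocked n (suc k) (Linked.tail sorted) ⟩
  flawsAbove n 0 r ⊔ (length r ∸ (n ∸ suc k))
    ≡⟨ cong₂ _⊔_ (sym (flaws-ordered n (Linked.tail sorted)))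
                 (trans (cong (_∸ (n ∸ suc k)) len) (m∸[m∸n]≡n k<n)) ⟩
  flaws n r ⊔ suc k
    ∎
  where open ≡-Reasoning

opTest-shift : ∀ {n k r} → suc k ≤ n → length r ≡ n →
               opTest (suc n) (suc k) (suc (suc k)) (suc (suc k) ∷ map suc r)
               ≡ isOrdered (suc k ∷ r) ∧ (flaws n r ⊔ suc k ≡ᵇ suc k)
opTest-shift {n} {k} {r} k<n len = ∧-cong-if (isOrdered-map-suc (suc k ∷ r)) λ ord →
  trans (cong₂ _∧_ (cong (_≡ᵇ suc k) (flaws-shift-lead k<n len (isOrdered⇒Linked ord)))
                   (≡ᵇ-refl (suc (suc k))))
        (∧-identityʳ _)

-- Invariant under (k, b, F) ↦ (k + 1, b + 1, F + 1), so only small cases remain.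
lead-indicator-split : ∀ k b F → pred b ≤ F →
  ind ((suc k ≤ᵇ b) ∧ (F ⊔ suc k ≡ᵇ suc k))
  ≡ ind ((F ≡ᵇ k) ∧ (suc k ≡ᵇ b)) + ind ((F ≡ᵇ suc k) ∧ (suc k ≡ᵇ b))
    + ind ((F ≡ᵇ suc k) ∧ (suc (suc k) ≡ᵇ b))
lead-indicator-split (suc k) (suc b) (suc F) b≤1+F = lead-indicator-split k b F (pred-mono-≤ b≤1+F)
lead-indicator-split k zero F _ rewrite ∧-zeroʳ (F ≡ᵇ k) | ∧-zeroʳ (F ≡ᵇ suc k) = refl
lead-indicator-split (suc k) (suc zero) zero _ = refl
lead-indicator-split zero (suc zero) zero _ = refl
lead-indicator-split zero (suc zero) (suc zero) _ = refl
lead-indicator-split zero (suc (suc zero)) (suc zero) _ = refl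
lead-indicator-split zero (suc b) (suc (suc F)) _ = refl
lead-indicator-split _ (suc (suc _)) zero ()
lead-indicator-split zero (suc (suc (suc _))) (suc zero) (s≤s ())

lead-split : ∀ {n k b r} → b ≤ n → length (b ∷ r) ≡ n →
  ind (((suc k ≤ᵇ b) ∧ isOrdered (b ∷ r)) ∧ (flaws n (b ∷ r) ⊔ suc k ≡ᵇ suc k))
  ≡ ind (opTest n k (suc k) (b ∷ r)) + ind (opTest n (suc k) (suc k) (b ∷ r))
    + ind (opTest n (suc k) (suc (suc k)) (b ∷ r))
lead-split {n} {k} {b} {r} b≤n len with isOrdered (b ∷ r) in ord
... | false rewrite ∧-zeroʳ (suc k ≤ᵇ b) = refl
... | true  rewrite ∧-identityʳ (suc k ≤ᵇ b) =
  lead-indicator-split k b (flaws n (b ∷ r))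
    (subst (pred b ≤_) (sym (flaws-ordered n {b ∷ r} (isOrdered⇒Linked ord))) (flawsAbove-lead r b≤n len))

opTest-shift-split : ∀ {n k} r → suc k ≤ n → length r ≡ n → All (_≤ n) r →
  ind (opTest (suc n) (suc k) (suc (suc k)) (suc (suc k) ∷ map suc r))
  ≡ ind (opTest n k (suc k) r) + ind (opTest n (suc k) (suc k) r) + ind (opTest n (suc k) (suc (suc k)) r)
opTest-shift-split []      k<n refl _         = contradiction k<n λ ()
opTest-shift-split {k = k} (b ∷ r) k<n len (b≤n ∷ _) =
  trans (cong ind (opTest-shift {r = b ∷ r} k<n len)) (lead-split {k = k} {r = r} b≤n len)

mainTheorem9 : (k n : ℕ) → n ≥ 1 →
    op (suc n) (suc k) (suc (suc k)) ≡ op n k (suc k) + op n (suc k) (suc k) + op n (suc k) (suc (suc k))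
mainTheorem9 k (suc n) _ with suc k ≤? suc n
... | yes k<N = begin
  op (suc N) (suc k) m
    ≡⟨ count-allSeqs-lead {L = N} (opTest (suc N) (suc k) m) (opTest-lead {suc N} {suc k})
                          (s≤s z≤n) (s≤s k<N) ⟩
  count (λ s → opTest (suc N) (suc k) m (m ∷ s)) (allSeqs (suc N) N)
    ≡⟨ count-allSeqs-shift N N _ (λ accept →
         All.tail (Linked⇒All ≤-trans (s≤s (s≤s z≤n)) (isOrdered⇒Linked (∧-conicalˡ _ _ accept)))) ⟩
  count (λ r → opTest (suc N) (suc k) m (m ∷ map suc r)) (allSeqs N N)
    ≡⟨ count-split₃ _ _ _ _ (allSeqs N N)
         (All.map (λ {r} (len , r≤N) → opTest-shift-split r k<N len r≤N) (allSeqs-shape N N)) ⟩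
  op N k (suc k) + op N (suc k) (suc k) + op N (suc k) m
    ∎
  where
  open ≡-Reasoning
  N = suc n
  m = suc (suc k)
... | no k≮N =
  trans (op-absent (s≤s N<k+1))
        (sym (cong₂ _+_ (cong₂ _+_ (op-absent N<k+1) (op-absent N<k+1)) (op-absent (m<n⇒m<1+n N<k+1))))
  where
  N<k+1 = ≰⇒> k≮N
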